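{- For all integers $m$ and $n$, \[ \sum_{k = (1+(-1)^n)/2}^n (-1)^{k - 1} L_{mk}^{\,4} = \frac{(-1)^{n - 1}\,5F_{mn} F_{mn + m} \left\{ L_m L_{mn} L_{mn + m} + (-1)^{nm}4L_{2m} \right\}}{L_m L_{2m}} . \] Thus the sum starts at $k=1$ when $n$ is even and at $k=0$ when $n$ is odd.
   Context: $F_n$ and $L_n$ ($n\in\mathbb{Z}$) are the Fibonacci and Lucas numbers: $F_n=F_{n-1}+F_{n-2}$ with $F_0=0$, $F_1=1$; $L_n=L_{n-1}+L_{n-2}$ with $L_0=2$, $L_1=1$; extended to negative indices by $F_{ -n}=(-1)^{n-1}F_n$, $L_{ -n}=(-1)^nL_n$. -}

module Defs where

open import Data.Nat as ℕ using (ℕ; zero; suc)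
open import Data.Integer using (ℤ; +_; -[1+_]; _+_; _-_; _*_; -_; 0ℤ; 1ℤ)
open import Data.Bool using (Bool; true; false; if_then_else_; not)

fibℕ : ℕ → ℕ
fibℕ zero = 0
fibℕ (suc zero) = 1
fibℕ (suc (suc n)) = fibℕ (suc n) ℕ.+ fibℕ n

lucℕ : ℕ → ℕ
lucℕ zero = 2
lucℕ (suc zero) = 1
lucℕ (suc (suc n)) = lucℕ (suc n) ℕ.+ lucℕ n

evenℕ : ℕ → Bool
evenℕ zero = true
evenℕ (suc n) = not (evenℕ n)

signℕ : ℕ → ℤ
signℕ k = if evenℕ k then 1ℤ else - 1ℤ

evenℤ : ℤ → Bool
evenℤ (+ n) = evenℕ n
evenℤ -[1+ n ] = evenℕ (suc n)

sgn : ℤ → ℤ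
sgn k = if evenℤ k then 1ℤ else - 1ℤ

-- F_n, n ∈ ℤ, with F_{-n} = (-1)^(n-1) F_n
F : ℤ → ℤ
F (+ n) = + fibℕ n
F -[1+ n ] = signℕ n * + fibℕ (suc n)

-- L_n, n ∈ ℤ, with L_{-n} = (-1)^n L_n
L : ℤ → ℤ
L (+ n) = + lucℕ n
L -[1+ n ] = signℕ (suc n) * + lucℕ (suc n)

sumFrom : ℤ → ℕ → (ℤ → ℤ) → ℤ
sumFrom a zero f = 0ℤ
sumFrom a (suc c) f = f a + sumFrom (a + 1ℤ) c f

-- Σ_{k=a}^{b} f k with the standard convention for reversed limits:
--   empty (= 0) when b = a - 1, and
--   Σ_{k=a}^{b} f k = - Σ_{k=b+1}^{a-1} f k  when b < a - 1.
sumRange : ℤ → ℤ → (ℤ → ℤ) → ℤ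
sumRange a b f with b - a + 1ℤ
... | + c = sumFrom a c f
... | -[1+ c ] = - sumFrom (b + 1ℤ) (suc c) f

-- the lower limit (1 + (-1)^n)/2 : 1 if n even, 0 if n odd
lowerLimit : ℤ → ℤ
lowerLimit n = if evenℤ n then 1ℤ else 0ℤ

{-# OPTIONS --safe #-}
-- Multiplied by L_m L_{2m}, both sides satisfy the same first-order recurrence in n ∈ ℤ and vanish
-- at n = 0. From n to n + 1 the lower limit (1 + (-1)^n)/2 flips between 1 and 0, so the sum gains
-- (-1)^n (L_{m(n+1)}^4 - 16). With x = mn, y = x + m, z = y + m the right-hand side gains the same,
-- because F_z L_z + F_x L_x = F_y L_y L_{2m} and F_z + (-1)^m F_x = F_y L_m (both instances of
-- F_{a+b} + (-1)^b F_{a-b} = F_a L_b, with F_{2a} = F_a L_a), and 5 F_y^2 = L_y^2 - 4 (-1)^y.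
-- The linear relations between F and L used for this (F's addition formula, 2 F_{k+1} = L_k + F_k,
-- 2 L_{k+1} = L_k + 5 F_k) need checking at 0 and 1 only, since a solution of
-- G_{k+2} = G_{k+1} + G_k on ℤ is determined by those two values.
module Submission where

open import Defs
open import Data.Integer using (ℤ; +_; -[1+_]; _+_; _-_; _*_; -_; _^_; 0ℤ; 1ℤ)
import Data.Integer.Properties as ℤP
open import Data.Integer.Tactic.RingSolver using (solve-∀; solve)
open import Data.Nat as ℕ using (zero; suc)
import Data.Nat.Properties as ℕP
open import Data.Bool using (Bool; true; false; if_then_else_; not)
open import Data.List using (_∷_; [])
open import Data.Product using (_×_; _,_)
open import Data.Product.Properties using (,-injectiveˡ; ,-injectiveʳ)
open import Algebra.Properties.AbelianGroup ℤP.+-0-abelianGroup using (∙-cancelˡ; ∙-cancelʳ)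
open import Algebra.Properties.CommutativeSemigroup ℤP.+-commutativeSemigroup using () renaming (interchange to +-interchange)
open import Relation.Binary.PropositionalEquality
open ≡-Reasoning

ℤ-ind : ∀ {p} (P : ℤ → Set p) → P 0ℤ → (∀ k → P k → P (k + 1ℤ)) → (∀ k → P (k + 1ℤ) → P k) → ∀ k → P k
ℤ-ind P p0 up down (+ zero) = p0
ℤ-ind P p0 up down (+ suc n) = subst P (cong +_ (ℕP.+-comm n 1)) (up (+ n) (ℤ-ind P p0 up down (+ n)))
ℤ-ind P p0 up down -[1+ zero ] = down -[1+ 0 ] p0
ℤ-ind P p0 up down -[1+ suc n ] = down -[1+ suc n ] (ℤ-ind P p0 up down -[1+ n ])

recurrence-unique : ∀ {a} {A : Set a} (step : ℤ → A → A) → (∀ k {x y} → step k x ≡ step k y → x ≡ y) →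
                    {f g : ℤ → A} → (∀ k → f (k + 1ℤ) ≡ step k (f k)) → (∀ k → g (k + 1ℤ) ≡ step k (g k)) →
                    f 0ℤ ≡ g 0ℤ → ∀ k → f k ≡ g k
recurrence-unique step step-injective {f} {g} f-step g-step f0≡g0 = ℤ-ind (λ k → f k ≡ g k) f0≡g0
  (λ k fk≡gk → trans (f-step k) (trans (cong (step k) fk≡gk) (sym (g-step k))))
  (λ k fk+1≡gk+1 → step-injective k (trans (sym (f-step k)) (trans fk+1≡gk+1 (g-step k))))

telescoping : ∀ (δ : ℤ → ℤ) {f g : ℤ → ℤ} → (∀ k → f (k + 1ℤ) ≡ f k + δ k) → (∀ k → g (k + 1ℤ) ≡ g k + δ k) →
              f 0ℤ ≡ g 0ℤ → ∀ k → f k ≡ g k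
telescoping δ = recurrence-unique (λ k x → x + δ k) (λ k {x} {y} → ∙-cancelʳ (δ k) x y)

alternating-unique : ∀ {f g : ℤ → ℤ} → (∀ k → f (k + 1ℤ) ≡ - f k) → (∀ k → g (k + 1ℤ) ≡ - g k) →
                     f 0ℤ ≡ g 0ℤ → ∀ k → f k ≡ g k
alternating-unique = recurrence-unique (λ _ x → - x) (λ _ → ℤP.neg-injective)

sign : Bool → ℤ
sign b = if b then 1ℤ else - 1ℤ

sign-not : ∀ b → sign (not b) ≡ - sign b
sign-not true = refl
sign-not false = refl

evenℤ-suc : ∀ k → evenℤ (k + 1ℤ) ≡ not (evenℤ k)
evenℤ-suc (+ n) = cong evenℕ (ℕP.+-comm n 1)
evenℤ-suc -[1+ zero ] = refl
evenℤ-suc -[1+ suc n ] with evenℕ n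
... | true = refl
... | false = refl

sgn-suc : ∀ k → sgn (k + 1ℤ) ≡ - sgn k
sgn-suc k = trans (cong sign (evenℤ-suc k)) (sign-not (evenℤ k))

sgn*sgn≡1 : ∀ k → sgn k * sgn k ≡ 1ℤ
sgn*sgn≡1 k with evenℤ k
... | true = refl
... | false = refl

sgn-+ : ∀ a b → sgn (a + b) ≡ sgn a * sgn b
sgn-+ a = alternating-unique
  (λ b → trans (cong sgn (sym (ℤP.+-assoc a b 1ℤ))) (sgn-suc (a + b)))
  (λ b → trans (cong (sgn a *_) (sgn-suc b)) (sym (ℤP.neg-distribʳ-* (sgn a) (sgn b))))
  (trans (cong sgn (ℤP.+-identityʳ a)) (sym (ℤP.*-identityʳ (sgn a))))

sgn-pred : ∀ k → sgn (k - 1ℤ) ≡ - sgn k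
sgn-pred k = trans (sgn-+ k (- 1ℤ)) (trans (ℤP.*-comm (sgn k) (- 1ℤ)) (ℤP.-1*i≡-i (sgn k)))

2*k≡k+k : ∀ k → + 2 * k ≡ k + k
2*k≡k+k = solve-∀

sgn-2* : ∀ k → sgn (+ 2 * k) ≡ 1ℤ
sgn-2* k = trans (cong sgn (2*k≡k+k k)) (trans (sgn-+ k k) (sgn*sgn≡1 k))

signedSum : ℤ → ℤ → (ℤ → ℤ) → ℤ
signedSum a (+ c) f = sumFrom a c f
signedSum a -[1+ c ] f = - sumFrom (a + -[1+ c ]) (suc c) f

sumRange≡signedSum : ∀ a b f → sumRange a b f ≡ signedSum a (b - a + 1ℤ) f
sumRange≡signedSum a b f with b - a + 1ℤ in eq
... | + c = refl
... | -[1+ c ] = cong (λ i → - sumFrom i (suc c) f) (begin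
  b + 1ℤ             ≡⟨ solve (a ∷ b ∷ []) ⟩
  a + (b - a + 1ℤ)   ≡⟨ cong (λ i → a + i) eq ⟩
  a + -[1+ c ]       ∎)

sumFrom-snoc : ∀ a c f → sumFrom a (suc c) f ≡ sumFrom a c f + f (a + + c)
sumFrom-snoc a zero f = trans (ℤP.+-comm (f a) 0ℤ) (cong (λ i → 0ℤ + f i) (sym (ℤP.+-identityʳ a)))
sumFrom-snoc a (suc c) f = begin
  f a + sumFrom (a + 1ℤ) (suc c) f                ≡⟨ cong (_+_ (f a)) (sumFrom-snoc (a + 1ℤ) c f) ⟩
  f a + (sumFrom (a + 1ℤ) c f + f (a + 1ℤ + + c)) ≡⟨ sym (ℤP.+-assoc (f a) _ _) ⟩
  f a + sumFrom (a + 1ℤ) c f + f (a + 1ℤ + + c)   ≡⟨ cong (λ i → f a + sumFrom (a + 1ℤ) c f + f i) (ℤP.+-assoc a 1ℤ (+ c)) ⟩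
  f a + sumFrom (a + 1ℤ) c f + f (a + + suc c)    ∎

-y≡-[x+y]+x : ∀ x y → - y ≡ - (x + y) + x
-y≡-[x+y]+x = solve-∀

signedSum-snoc : ∀ a c f → signedSum a (c + 1ℤ) f ≡ signedSum a c f + f (a + c)
signedSum-snoc a (+ c) f = trans (cong (λ i → signedSum a i f) (cong +_ (ℕP.+-comm c 1))) (sumFrom-snoc a c f)
signedSum-snoc a -[1+ zero ] f = -y≡-[x+y]+x (f (a + -[1+ 0 ])) 0ℤ
signedSum-snoc a -[1+ suc c ] f = begin
  - sumFrom (a + -[1+ c ]) (suc c) f           ≡⟨ cong (λ i → - sumFrom i (suc c) f) (sym (ℤP.+-assoc a -[1+ suc c ] 1ℤ)) ⟩
  - sumFrom (a + -[1+ suc c ] + 1ℤ) (suc c) f  ≡⟨ -y≡-[x+y]+x (f (a + -[1+ suc c ])) _ ⟩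
  signedSum a -[1+ suc c ] f + f (a + -[1+ suc c ]) ∎

signedSum-cons : ∀ a c f → signedSum a (c + 1ℤ) f ≡ f a + signedSum (a + 1ℤ) c f
signedSum-cons a c f = telescoping (λ c → f (a + (c + 1ℤ)))
  (λ c → signedSum-snoc a (c + 1ℤ) f)
  (λ c → begin
    f a + signedSum (a + 1ℤ) (c + 1ℤ) f              ≡⟨ cong (_+_ (f a)) (signedSum-snoc (a + 1ℤ) c f) ⟩
    f a + (signedSum (a + 1ℤ) c f + f (a + 1ℤ + c))  ≡⟨ sym (ℤP.+-assoc (f a) _ _) ⟩
    f a + signedSum (a + 1ℤ) c f + f (a + 1ℤ + c)    ≡⟨ cong (λ i → f a + signedSum (a + 1ℤ) c f + f i) (solve (a ∷ c ∷ [])) ⟩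
    f a + signedSum (a + 1ℤ) c f + f (a + (c + 1ℤ))  ∎)
  refl c

sumRange-snoc : ∀ a b f → sumRange a (b + 1ℤ) f ≡ sumRange a b f + f (b + 1ℤ)
sumRange-snoc a b f = begin
  sumRange a (b + 1ℤ) f                        ≡⟨ sumRange≡signedSum a (b + 1ℤ) f ⟩
  signedSum a (b + 1ℤ - a + 1ℤ) f              ≡⟨ cong (λ i → signedSum a i f) length≡ ⟩
  signedSum a (b - a + 1ℤ + 1ℤ) f              ≡⟨ signedSum-snoc a (b - a + 1ℤ) f ⟩
  signedSum a (b - a + 1ℤ) f + f (a + (b - a + 1ℤ)) ≡⟨ cong₂ (λ s i → s + f i) (sym (sumRange≡signedSum a b f)) (solve (a ∷ b ∷ [])) ⟩
  sumRange a b f + f (b + 1ℤ)                  ∎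
  where length≡ : b + 1ℤ - a + 1ℤ ≡ b - a + 1ℤ + 1ℤ
        length≡ = solve (a ∷ b ∷ [])

sumRange-cons : ∀ a b f → sumRange a b f ≡ f a + sumRange (a + 1ℤ) b f
sumRange-cons a b f = begin
  sumRange a b f                                  ≡⟨ sumRange≡signedSum a b f ⟩
  signedSum a (b - a + 1ℤ) f                      ≡⟨ cong (λ i → signedSum a i f) length≡ ⟩
  signedSum a (b - (a + 1ℤ) + 1ℤ + 1ℤ) f          ≡⟨ signedSum-cons a (b - (a + 1ℤ) + 1ℤ) f ⟩
  f a + signedSum (a + 1ℤ) (b - (a + 1ℤ) + 1ℤ) f  ≡⟨ cong (_+_ (f a)) (sym (sumRange≡signedSum (a + 1ℤ) b f)) ⟩
  f a + sumRange (a + 1ℤ) b f                     ∎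
  where length≡ : b - a + 1ℤ ≡ b - (a + 1ℤ) + 1ℤ + 1ℤ
        length≡ = solve (a ∷ b ∷ [])

sumRange-from-0-or-1 : ∀ b n f → sumRange (if not b then 1ℤ else 0ℤ) n f ≡ sumRange (if b then 1ℤ else 0ℤ) n f + sign b * f 0ℤ
sumRange-from-0-or-1 true n f = trans (sumRange-cons 0ℤ n f) (rearrange (f 0ℤ) (sumRange 1ℤ n f))
  where rearrange : ∀ x s → x + s ≡ s + 1ℤ * x
        rearrange = solve-∀
sumRange-from-0-or-1 false n f = trans (rearrange (f 0ℤ) (sumRange 1ℤ n f)) (cong (λ s → s + - 1ℤ * f 0ℤ) (sym (sumRange-cons 0ℤ n f)))
  where rearrange : ∀ x s → s ≡ x + s + - 1ℤ * x
        rearrange = solve-∀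

sumRange-lowerLimit-suc : ∀ n f → sumRange (lowerLimit (n + 1ℤ)) (n + 1ℤ) f ≡ sumRange (lowerLimit n) n f + sgn n * f 0ℤ + f (n + 1ℤ)
sumRange-lowerLimit-suc n f = begin
  sumRange (lowerLimit (n + 1ℤ)) (n + 1ℤ) f                  ≡⟨ sumRange-snoc (lowerLimit (n + 1ℤ)) n f ⟩
  sumRange (lowerLimit (n + 1ℤ)) n f + f (n + 1ℤ)            ≡⟨ cong (λ b → sumRange (if b then 1ℤ else 0ℤ) n f + f (n + 1ℤ)) (evenℤ-suc n) ⟩
  sumRange (if not (evenℤ n) then 1ℤ else 0ℤ) n f + f (n + 1ℤ) ≡⟨ cong (λ s → s + f (n + 1ℤ)) (sumRange-from-0-or-1 (evenℤ n) n f) ⟩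
  sumRange (lowerLimit n) n f + sgn n * f 0ℤ + f (n + 1ℤ)    ∎

record IsGibonacci (G : ℤ → ℤ) : Set where
  constructor gibonacci
  field recurrence : ∀ k → G (k + 1ℤ + 1ℤ) ≡ G (k + 1ℤ) + G k
open IsGibonacci

sign-gibonacci : ∀ b x y → sign b * x ≡ sign (not b) * (x + y) + sign (not (not b)) * (x + y + x)
sign-gibonacci true = solve-∀
sign-gibonacci false = solve-∀

pos-+-+ : ∀ x y → + (x ℕ.+ y ℕ.+ x) ≡ + x + + y + + x
pos-+-+ x y = trans (ℤP.pos-+ (x ℕ.+ y) x) (cong (λ i → i + + x) (ℤP.pos-+ x y))

F-recurrence : ∀ k → F (k + 1ℤ + 1ℤ) ≡ F (k + 1ℤ) + F k
F-recurrence (+ n) rewrite ℕP.+-comm (n ℕ.+ 1) 1 | ℕP.+-comm n 1 = ℤP.pos-+ (fibℕ (suc n)) (fibℕ n)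
F-recurrence -[1+ zero ] = refl
F-recurrence -[1+ suc zero ] = refl
F-recurrence -[1+ suc (suc j) ] = trans (sign-gibonacci (evenℕ j) (+ fibℕ (suc j)) (+ fibℕ j))
  (sym (cong₂ (λ u v → sign (not (evenℕ j)) * u + sign (not (not (evenℕ j))) * v)
              (ℤP.pos-+ (fibℕ (suc j)) (fibℕ j)) (pos-+-+ (fibℕ (suc j)) (fibℕ j))))

L-recurrence : ∀ k → L (k + 1ℤ + 1ℤ) ≡ L (k + 1ℤ) + L k
L-recurrence (+ n) rewrite ℕP.+-comm (n ℕ.+ 1) 1 | ℕP.+-comm n 1 = ℤP.pos-+ (lucℕ (suc n)) (lucℕ n)
L-recurrence -[1+ zero ] = refl
L-recurrence -[1+ suc zero ] = refl
L-recurrence -[1+ suc (suc j) ] = trans (sign-gibonacci (evenℕ (suc j)) (+ lucℕ (suc j)) (+ lucℕ j))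
  (sym (cong₂ (λ u v → sign (not (evenℕ (suc j))) * u + sign (not (not (evenℕ (suc j)))) * v)
              (ℤP.pos-+ (lucℕ (suc j)) (lucℕ j)) (pos-+-+ (lucℕ (suc j)) (lucℕ j))))

F-gibonacci : IsGibonacci F
F-gibonacci = gibonacci F-recurrence

L-gibonacci : IsGibonacci L
L-gibonacci = gibonacci L-recurrence

fibonacciStep : ℤ × ℤ → ℤ × ℤ
fibonacciStep (x , y) = y , y + x

fibonacciStep-injective : ∀ {p q} → fibonacciStep p ≡ fibonacciStep q → p ≡ q
fibonacciStep-injective {x , y} {x₁ , y₁} eq = cong₂ _,_ x≡x₁ y≡y₁
  where
  y≡y₁ = ,-injectiveˡ eq
  x≡x₁ = ∙-cancelˡ y x x₁ (trans (,-injectiveʳ eq) (cong (λ i → i + x₁) (sym y≡y₁)))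

gibonacci-unique : ∀ {G H} → IsGibonacci G → IsGibonacci H → G 0ℤ ≡ H 0ℤ → G 1ℤ ≡ H 1ℤ → ∀ k → G k ≡ H k
gibonacci-unique {G} {H} G-rec H-rec G0≡H0 G1≡H1 k = ,-injectiveˡ
  (recurrence-unique (λ _ → fibonacciStep) (λ _ → fibonacciStep-injective)
    (λ k → cong (_,_ (G (k + 1ℤ))) (recurrence G-rec k))
    (λ k → cong (_,_ (H (k + 1ℤ))) (recurrence H-rec k))
    (cong₂ _,_ G0≡H0 G1≡H1) k)

gibonacci-shift : ∀ {G} a → IsGibonacci G → IsGibonacci (λ k → G (k + a))
gibonacci-shift {G} a G-rec = gibonacci λ k → begin
  G (k + 1ℤ + 1ℤ + a)          ≡⟨ cong G (solve (k ∷ a ∷ [])) ⟩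
  G (k + a + 1ℤ + 1ℤ)          ≡⟨ recurrence G-rec (k + a) ⟩
  G (k + a + 1ℤ) + G (k + a)   ≡⟨ cong (λ i → G i + G (k + a)) (solve (k ∷ a ∷ [])) ⟩
  G (k + 1ℤ + a) + G (k + a)   ∎

gibonacci-scale : ∀ {G} u → IsGibonacci G → IsGibonacci (λ k → u * G k)
gibonacci-scale {G} u G-rec = gibonacci λ k → trans (cong (_*_ u) (recurrence G-rec k)) (ℤP.*-distribˡ-+ u (G (k + 1ℤ)) (G k))

gibonacci-+ : ∀ {G H} → IsGibonacci G → IsGibonacci H → IsGibonacci (λ k → G k + H k)
gibonacci-+ {G} {H} G-rec H-rec = gibonacci λ k →
  trans (cong₂ _+_ (recurrence G-rec k) (recurrence H-rec k)) (+-interchange (G (k + 1ℤ)) (G k) (H (k + 1ℤ)) (H k))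

L+F≡2F[k+1] : ∀ k → L k + F k ≡ + 2 * F (k + 1ℤ)
L+F≡2F[k+1] = gibonacci-unique (gibonacci-+ L-gibonacci F-gibonacci)
  (gibonacci-scale (+ 2) (gibonacci-shift 1ℤ F-gibonacci)) refl refl

L+5F≡2L[k+1] : ∀ k → L k + + 5 * F k ≡ + 2 * L (k + 1ℤ)
L+5F≡2L[k+1] = gibonacci-unique (gibonacci-+ L-gibonacci (gibonacci-scale (+ 5) F-gibonacci))
  (gibonacci-scale (+ 2) (gibonacci-shift 1ℤ L-gibonacci)) refl refl

F-+ : ∀ x y → + 2 * F (x + y) ≡ F x * L y + L x * F y
F-+ x y = trans (cong (λ i → + 2 * F i) (ℤP.+-comm x y))
  (gibonacci-unique (gibonacci-scale (+ 2) (gibonacci-shift x F-gibonacci))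
                    (gibonacci-+ (gibonacci-scale (F x) L-gibonacci) (gibonacci-scale (L x) F-gibonacci))
                    (trans (cong (λ i → + 2 * F i) (ℤP.+-identityˡ x)) (at-0 (F x) (L x)))
                    (trans (cong (λ i → + 2 * F i) (ℤP.+-comm 1ℤ x)) (trans (sym (L+F≡2F[k+1] x)) (at-1 (F x) (L x))))
                    y)
  where at-0 : ∀ f l → + 2 * f ≡ f * + 2 + l * 0ℤ
        at-0 = solve-∀
        at-1 : ∀ f l → l + f ≡ f * 1ℤ + l * 1ℤ
        at-1 = solve-∀

F-neg : ∀ k → F (- k) ≡ - (sgn k * F k)
F-neg (+ zero) = refl
F-neg (+ suc n) = flip (evenℕ n) (+ fibℕ (suc n))
  where flip : ∀ b x → sign b * x ≡ - (sign (not b) * x)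
        flip true = solve-∀
        flip false = solve-∀
F-neg -[1+ n ] = flip (evenℕ n) (+ fibℕ (suc n))
  where flip : ∀ b x → x ≡ - (sign (not b) * (sign b * x))
        flip true = solve-∀
        flip false = solve-∀

L-neg : ∀ k → L (- k) ≡ sgn k * L k
L-neg (+ zero) = refl
L-neg (+ suc n) = refl
L-neg -[1+ n ] = flip (evenℕ (suc n)) (+ lucℕ (suc n))
  where flip : ∀ b x → x ≡ sign b * (sign b * x)
        flip true = solve-∀
        flip false = solve-∀

F-+- : ∀ a b → F (a + b) + sgn b * F (a - b) ≡ F a * L b
F-+- a b = ℤP.*-cancelˡ-≡ (+ 2) _ _ (begin
  + 2 * (F (a + b) + sgn b * F (a - b))
    ≡⟨ double-sum (F (a + b)) (sgn b) (F (a - b)) ⟩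
  + 2 * F (a + b) + sgn b * (+ 2 * F (a - b))
    ≡⟨ cong₂ (λ u v → u + sgn b * v) (F-+ a b) (F-+ a (- b)) ⟩
  F a * L b + L a * F b + sgn b * (F a * L (- b) + L a * F (- b))
    ≡⟨ cong₂ (λ u v → F a * L b + L a * F b + sgn b * (F a * u + L a * v)) (L-neg b) (F-neg b) ⟩
  F a * L b + L a * F b + sgn b * (F a * (sgn b * L b) + L a * - (sgn b * F b))
    ≡⟨ cancel-sign (F a) (L a) (F b) (L b) (sgn b) (sgn*sgn≡1 b) ⟩
  + 2 * (F a * L b) ∎)
  where
  double-sum : ∀ x t y → + 2 * (x + t * y) ≡ + 2 * x + t * (+ 2 * y)
  double-sum = solve-∀
  cancel-sign : ∀ fa la fb lb t → t * t ≡ 1ℤ →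
                fa * lb + la * fb + t * (fa * (t * lb) + la * - (t * fb)) ≡ + 2 * (fa * lb)
  cancel-sign fa la fb lb t t*t≡1 = begin
    fa * lb + la * fb + t * (fa * (t * lb) + la * - (t * fb)) ≡⟨ solve (fa ∷ la ∷ fb ∷ lb ∷ t ∷ []) ⟩
    fa * lb + la * fb + t * t * (fa * lb - la * fb)           ≡⟨ cong (λ s → fa * lb + la * fb + s * (fa * lb - la * fb)) t*t≡1 ⟩
    fa * lb + la * fb + 1ℤ * (fa * lb - la * fb)              ≡⟨ solve (fa ∷ la ∷ fb ∷ lb ∷ []) ⟩
    + 2 * (fa * lb)                                           ∎

F-double : ∀ a → F (+ 2 * a) ≡ F a * L a
F-double a = ℤP.*-cancelˡ-≡ (+ 2) _ _ (begin
  + 2 * F (+ 2 * a)     ≡⟨ cong (λ i → + 2 * F i) (2*k≡k+k a) ⟩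
  + 2 * F (a + a)       ≡⟨ F-+ a a ⟩
  F a * L a + L a * F a ≡⟨ fl+lf≡2fl (F a) (L a) ⟩
  + 2 * (F a * L a)     ∎)
  where
  fl+lf≡2fl : ∀ f l → f * l + l * f ≡ + 2 * (f * l)
  fl+lf≡2fl = solve-∀

L²-5F²≡4sgn : ∀ k → L k * L k - + 5 * (F k * F k) ≡ + 4 * sgn k
L²-5F²≡4sgn = alternating-unique
  (λ k → ℤP.*-cancelˡ-≡ (+ 4) _ _ (norm-step (L k) (F k) (L (k + 1ℤ)) (F (k + 1ℤ)) (L+5F≡2L[k+1] k) (L+F≡2F[k+1] k)))
  (λ k → trans (cong (_*_ (+ 4)) (sgn-suc k)) (sym (ℤP.neg-distribʳ-* (+ 4) (sgn k))))
  refl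
  where
  norm-step : ∀ l f l₁ f₁ → l + + 5 * f ≡ + 2 * l₁ → l + f ≡ + 2 * f₁ →
              + 4 * (l₁ * l₁ - + 5 * (f₁ * f₁)) ≡ + 4 * - (l * l - + 5 * (f * f))
  norm-step l f l₁ f₁ 2l₁≡ 2f₁≡ = begin
    + 4 * (l₁ * l₁ - + 5 * (f₁ * f₁))                        ≡⟨ solve (l₁ ∷ f₁ ∷ []) ⟩
    + 2 * l₁ * (+ 2 * l₁) - + 5 * (+ 2 * f₁ * (+ 2 * f₁))    ≡⟨ cong₂ (λ u v → u * u - + 5 * (v * v)) (sym 2l₁≡) (sym 2f₁≡) ⟩
    (l + + 5 * f) * (l + + 5 * f) - + 5 * ((l + f) * (l + f)) ≡⟨ solve (l ∷ f ∷ []) ⟩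
    + 4 * - (l * l - + 5 * (f * f))                           ∎

FL-+-FL : ∀ y m → F (y + m) * L (y + m) + F (y - m) * L (y - m) ≡ F y * L y * L (+ 2 * m)
FL-+-FL y m = begin
  F (y + m) * L (y + m) + F (y - m) * L (y - m)          ≡⟨ sym (cong₂ _+_ (F-double (y + m)) (F-double (y - m))) ⟩
  F (+ 2 * (y + m)) + F (+ 2 * (y - m))                  ≡⟨ cong₂ (λ u v → F u + v) 2[y+m]≡ F2[y-m]≡ ⟩
  F (+ 2 * y + + 2 * m) + sgn (+ 2 * m) * F (+ 2 * y - + 2 * m) ≡⟨ F-+- (+ 2 * y) (+ 2 * m) ⟩
  F (+ 2 * y) * L (+ 2 * m)                              ≡⟨ cong (λ u → u * L (+ 2 * m)) (F-double y) ⟩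
  F y * L y * L (+ 2 * m)                                ∎
  where
  2[y+m]≡ : + 2 * (y + m) ≡ + 2 * y + + 2 * m
  2[y+m]≡ = ℤP.*-distribˡ-+ (+ 2) y m
  F2[y-m]≡ : F (+ 2 * (y - m)) ≡ sgn (+ 2 * m) * F (+ 2 * y - + 2 * m)
  F2[y-m]≡ = begin
    F (+ 2 * (y - m))                        ≡⟨ cong F (ℤP.*-distribˡ-+ (+ 2) y (- m)) ⟩
    F (+ 2 * y + + 2 * - m)                  ≡⟨ cong (λ i → F (+ 2 * y + i)) (sym (ℤP.neg-distribʳ-* (+ 2) m)) ⟩
    F (+ 2 * y - + 2 * m)                    ≡⟨ sym (ℤP.*-identityˡ _) ⟩
    1ℤ * F (+ 2 * y - + 2 * m)               ≡⟨ cong (λ s → s * F (+ 2 * y - + 2 * m)) (sym (sgn-2* m)) ⟩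
    sgn (+ 2 * m) * F (+ 2 * y - + 2 * m)    ∎

quartic-algebra : ∀ Fx Lx Fy Ly Fz Lz Lm L2m sy sx sm →
  Fz * Lz + Fx * Lx ≡ Fy * Ly * L2m → Fz + sm * Fx ≡ Fy * Lm → Ly * Ly - + 5 * (Fy * Fy) ≡ + 4 * sy →
  sy ≡ sx * sm → sx * sx ≡ 1ℤ → sm * sm ≡ 1ℤ →
  + 5 * Fy * (Fz * (Lm * Ly * Lz + sy * + 4 * L2m) + Fx * (Lm * Lx * Ly + sx * + 4 * L2m)) ≡ (Ly ^ 4 - + 16) * (Lm * L2m)
quartic-algebra Fx Lx Fy Ly Fz Lz Lm L2m .(sx * sm) sx sm FzLz+FxLx≡ Fz+smFx≡ Ly²-5Fy²≡ refl sx*sx≡1 sm*sm≡1 = begin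
  + 5 * Fy * (Fz * (Lm * Ly * Lz + sx * sm * + 4 * L2m) + Fx * (Lm * Lx * Ly + sx * + 4 * L2m))
    ≡⟨ solve (Fx ∷ Lx ∷ Fy ∷ Ly ∷ Fz ∷ Lz ∷ Lm ∷ L2m ∷ sx ∷ sm ∷ []) ⟩
  + 5 * Fy * (Lm * Ly * (Fz * Lz + Fx * Lx) + + 4 * L2m * sx * (sm * Fz + 1ℤ * Fx))
    ≡⟨ cong (λ u → + 5 * Fy * (Lm * Ly * (Fz * Lz + Fx * Lx) + + 4 * L2m * sx * (sm * Fz + u * Fx))) (sym sm*sm≡1) ⟩
  + 5 * Fy * (Lm * Ly * (Fz * Lz + Fx * Lx) + + 4 * L2m * sx * (sm * Fz + sm * sm * Fx))
    ≡⟨ solve (Fx ∷ Lx ∷ Fy ∷ Ly ∷ Fz ∷ Lz ∷ Lm ∷ L2m ∷ sx ∷ sm ∷ []) ⟩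
  + 5 * Fy * (Lm * Ly * (Fz * Lz + Fx * Lx) + + 4 * L2m * sx * sm * (Fz + sm * Fx))
    ≡⟨ cong₂ (λ u v → + 5 * Fy * (Lm * Ly * u + + 4 * L2m * sx * sm * v)) FzLz+FxLx≡ Fz+smFx≡ ⟩
  + 5 * Fy * (Lm * Ly * (Fy * Ly * L2m) + + 4 * L2m * sx * sm * (Fy * Lm))
    ≡⟨ solve (Fy ∷ Ly ∷ Lm ∷ L2m ∷ sx ∷ sm ∷ []) ⟩
  + 5 * (Fy * Fy) * (Ly * Ly + + 4 * (sx * sm)) * (Lm * L2m)
    ≡⟨ cong (λ u → u * (Ly * Ly + + 4 * (sx * sm)) * (Lm * L2m)) 5Fy²≡Ly²-4sy ⟩
  (Ly * Ly - + 4 * (sx * sm)) * (Ly * Ly + + 4 * (sx * sm)) * (Lm * L2m)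
    ≡⟨ solve (Ly ∷ Lm ∷ L2m ∷ sx ∷ sm ∷ []) ⟩
  (Ly * (Ly * (Ly * (Ly * 1ℤ))) - + 16 * (sx * sx * (sm * sm))) * (Lm * L2m)
    ≡⟨⟩
  (Ly ^ 4 - + 16 * (sx * sx * (sm * sm))) * (Lm * L2m)
    ≡⟨ cong₂ (λ u v → (Ly ^ 4 - + 16 * (u * v)) * (Lm * L2m)) sx*sx≡1 sm*sm≡1 ⟩
  (Ly ^ 4 - + 16) * (Lm * L2m) ∎
  where
  5Fy²≡Ly²-4sy : + 5 * (Fy * Fy) ≡ Ly * Ly - + 4 * (sx * sm)
  5Fy²≡Ly²-4sy = begin
    + 5 * (Fy * Fy)                       ≡⟨ solve (Fy ∷ Ly ∷ []) ⟩
    Ly * Ly - (Ly * Ly - + 5 * (Fy * Fy)) ≡⟨ cong (λ u → Ly * Ly - u) Ly²-5Fy²≡ ⟩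
    Ly * Ly - + 4 * (sx * sm)             ∎

quartic-identity : ∀ x m →
  + 5 * F (x + m) * (F (x + m + m) * (L m * L (x + m) * L (x + m + m) + sgn (x + m) * + 4 * L (+ 2 * m))
                     + F x * (L m * L x * L (x + m) + sgn x * + 4 * L (+ 2 * m)))
  ≡ (L (x + m) ^ 4 - + 16) * (L m * L (+ 2 * m))
quartic-identity x m = quartic-algebra (F x) (L x) (F y) (L y) (F (y + m)) (L (y + m)) (L m) (L (+ 2 * m)) (sgn y) (sgn x) (sgn m)
  (subst (λ w → F (y + m) * L (y + m) + F w * L w ≡ F y * L y * L (+ 2 * m)) y-m≡x (FL-+-FL y m))
  (subst (λ w → F (y + m) + sgn m * F w ≡ F y * L m) y-m≡x (F-+- y m))
  (L²-5F²≡4sgn y) (sgn-+ x m) (sgn*sgn≡1 x) (sgn*sgn≡1 m)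
  where
  y = x + m
  y-m≡x : x + m - m ≡ x
  y-m≡x = solve (x ∷ m ∷ [])

quarticSum : ℤ → ℤ → ℤ
quarticSum m n = sumRange (lowerLimit n) n (λ k → sgn (k - 1ℤ) * L (m * k) ^ 4)

closedForm : ℤ → ℤ → ℤ → ℤ → ℤ
closedForm m σ x σ′ = σ * + 5 * F x * F (x + m) * (L m * L x * L (x + m) + σ′ * + 4 * L (+ 2 * m))

quarticClosedForm : ℤ → ℤ → ℤ
quarticClosedForm m n = closedForm m (sgn (n - 1ℤ)) (m * n) (sgn (n * m))

n+1-1≡n : ∀ n → n + 1ℤ - 1ℤ ≡ n
n+1-1≡n = solve-∀

m[n+1]≡mn+m : ∀ m n → m * (n + 1ℤ) ≡ m * n + m
m[n+1]≡mn+m = solve-∀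

quarticSum-suc : ∀ m n → quarticSum m (n + 1ℤ) ≡ quarticSum m n + sgn n * (L (m * n + m) ^ 4 - + 16)
quarticSum-suc m n = begin
  quarticSum m (n + 1ℤ)                                         ≡⟨ sumRange-lowerLimit-suc n f ⟩
  quarticSum m n + sgn n * f 0ℤ + f (n + 1ℤ)                    ≡⟨ cong₂ (λ u v → quarticSum m n + sgn n * u + v) f[0]≡-16 f[n+1]≡ ⟩
  quarticSum m n + sgn n * - + 16 + sgn n * L (m * n + m) ^ 4   ≡⟨ collect (quarticSum m n) (sgn n) (L (m * n + m) ^ 4) ⟩
  quarticSum m n + sgn n * (L (m * n + m) ^ 4 - + 16)           ∎
  where
  f : ℤ → ℤ
  f k = sgn (k - 1ℤ) * L (m * k) ^ 4
  f[0]≡-16 : f 0ℤ ≡ - + 16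
  f[0]≡-16 = cong (λ i → sgn (0ℤ - 1ℤ) * L i ^ 4) (ℤP.*-zeroʳ m)
  f[n+1]≡ : f (n + 1ℤ) ≡ sgn n * L (m * n + m) ^ 4
  f[n+1]≡ = cong₂ (λ u v → sgn u * L v ^ 4) (n+1-1≡n n) (m[n+1]≡mn+m m n)
  collect : ∀ S σ Y → S + σ * - + 16 + σ * Y ≡ S + σ * (Y - + 16)
  collect = solve-∀

telescope-term : ∀ σ σ′ Fx Fy Fz Pz Px D Q → σ′ ≡ - σ → + 5 * Fy * (Fz * Pz + Fx * Px) ≡ D * Q →
                 σ * + 5 * Fy * Fz * Pz ≡ σ′ * + 5 * Fx * Fy * Px + σ * D * Q
telescope-term σ .(- σ) Fx Fy Fz Pz Px D Q refl key = begin
  σ * + 5 * Fy * Fz * Pz                                           ≡⟨ solve (σ ∷ Fx ∷ Fy ∷ Fz ∷ Pz ∷ Px ∷ []) ⟩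
  - σ * + 5 * Fx * Fy * Px + σ * (+ 5 * Fy * (Fz * Pz + Fx * Px)) ≡⟨ cong (λ u → - σ * + 5 * Fx * Fy * Px + σ * u) key ⟩
  - σ * + 5 * Fx * Fy * Px + σ * (D * Q)                           ≡⟨ cong (_+_ (- σ * + 5 * Fx * Fy * Px)) (sym (ℤP.*-assoc σ D Q)) ⟩
  - σ * + 5 * Fx * Fy * Px + σ * D * Q                             ∎

quarticClosedForm-suc : ∀ m n → quarticClosedForm m (n + 1ℤ)
  ≡ quarticClosedForm m n + sgn n * (L (m * n + m) ^ 4 - + 16) * (L m * L (+ 2 * m))
quarticClosedForm-suc m n = begin
  closedForm m (sgn (n + 1ℤ - 1ℤ)) (m * (n + 1ℤ)) (sgn ((n + 1ℤ) * m))
    ≡⟨ cong₂ (λ σ x → closedForm m σ x (sgn ((n + 1ℤ) * m))) (cong sgn (n+1-1≡n n)) (m[n+1]≡mn+m m n) ⟩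
  closedForm m (sgn n) y (sgn ((n + 1ℤ) * m))
    ≡⟨ cong (λ i → closedForm m (sgn n) y (sgn i)) (trans (ℤP.*-comm (n + 1ℤ) m) (m[n+1]≡mn+m m n)) ⟩
  closedForm m (sgn n) y (sgn y)
    ≡⟨ telescope-term (sgn n) (sgn (n - 1ℤ)) (F x) (F y) (F (y + m)) _ _ _ _ (sgn-pred n) (quartic-identity x m) ⟩
  closedForm m (sgn (n - 1ℤ)) x (sgn x) + sgn n * (L y ^ 4 - + 16) * (L m * L (+ 2 * m))
    ≡⟨ cong (λ i → closedForm m (sgn (n - 1ℤ)) x (sgn i) + sgn n * (L y ^ 4 - + 16) * (L m * L (+ 2 * m))) (ℤP.*-comm m n) ⟩
  quarticClosedForm m n + sgn n * (L y ^ 4 - + 16) * (L m * L (+ 2 * m)) ∎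
  where
  x = m * n
  y = x + m

mainTheorem4 : (m n : ℤ) →
    sumRange (lowerLimit n) n (λ k → sgn (k - 1ℤ) * L (m * k) ^ 4) * (L m * L (+ 2 * m))
      ≡ sgn (n - 1ℤ) * + 5 * F (m * n) * F (m * n + m)
          * (L m * L (m * n) * L (m * n + m) + sgn (n * m) * + 4 * L (+ 2 * m))
mainTheorem4 m n = telescoping (λ k → sgn k * (L (m * k + m) ^ 4 - + 16) * Q) {λ k → quarticSum m k * Q} {quarticClosedForm m}
  (λ k → trans (cong (λ s → s * Q) (quarticSum-suc m k)) (ℤP.*-distribʳ-+ Q (quarticSum m k) _))
  (quarticClosedForm-suc m)
  (sym (cong (λ x → closedForm m (sgn (0ℤ - 1ℤ)) x (sgn (0ℤ * m))) (ℤP.*-zeroʳ m)))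
  n
  where
  Q = L m * L (+ 2 * m)
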